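{- Every space $A\in\mathcal{A}^3_{\infty,0,7,8}$ has at most two maximal $2$-cliques.
   Context: $\mathcal{A}^3_{\infty,0,7,8}$ is the class of finite metric spaces, all of whose distances between distinct points lie in $\{1,2,3\}$, in which for every three distinct points the multiset of their pairwise distances is one of $\{1,1,2\}$, $\{1,2,3\}$, $\{2,2,2\}$. A $2$-clique in such a space is a set of points any two distinct members of which are at distance $2$; it is maximal if it is not properly contained in a larger $2$-clique. -}

module Defs where

open import Data.Nat using (ℕ; _+_; _≤_)
open import Data.Fin using (Fin)
open import Data.Fin.Subset using (Subset; _∈_; _⊆_; _⊂_)
open import Data.Product using (_×_)
open import Data.Sum using (_⊎_)
open import Relation.Binary.PropositionalEquality using (_≡_; _≢_)
open import Relation.Nullary using (¬_)

record FiniteMetric (n : ℕ) : Set where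
  field
    dist      : Fin n → Fin n → ℕ
    dist-self : ∀ x → dist x x ≡ 0
    dist-pos  : ∀ x y → x ≢ y → ¬ (dist x y ≡ 0)
    dist-sym  : ∀ x y → dist x y ≡ dist y x
    dist-tri  : ∀ x y z → dist x z ≤ dist x y + dist y z

open FiniteMetric public

SameMultiset : ℕ → ℕ → ℕ → ℕ → ℕ → ℕ → Set
SameMultiset a b c p q r =
    (a ≡ p × b ≡ q × c ≡ r) ⊎ (a ≡ p × b ≡ r × c ≡ q)
  ⊎ (a ≡ q × b ≡ p × c ≡ r) ⊎ (a ≡ q × b ≡ r × c ≡ p)
  ⊎ (a ≡ r × b ≡ p × c ≡ q) ⊎ (a ≡ r × b ≡ q × c ≡ p)

AllowedTriangle : ℕ → ℕ → ℕ → Set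
AllowedTriangle a b c =
  SameMultiset a b c 1 1 2 ⊎ SameMultiset a b c 1 2 3 ⊎ SameMultiset a b c 2 2 2

InClass : ∀ {n} → FiniteMetric n → Set
InClass {n} M =
  (∀ (x y : Fin n) → x ≢ y → (dist M x y ≡ 1 ⊎ dist M x y ≡ 2 ⊎ dist M x y ≡ 3))
  × (∀ (x y z : Fin n) → x ≢ y → y ≢ z → x ≢ z →
       AllowedTriangle (dist M x y) (dist M y z) (dist M x z))

TwoClique : ∀ {n} → FiniteMetric n → Subset n → Set
TwoClique {n} M C = ∀ (x y : Fin n) → x ∈ C → y ∈ C → x ≢ y → dist M x y ≡ 2

MaximalTwoClique : ∀ {n} → FiniteMetric n → Subset n → Set
MaximalTwoClique {n} M C =
  TwoClique M C × (∀ (D : Subset n) → TwoClique M D → ¬ (C ⊂ D))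

-- In an allowed triangle the number of sides of length 2 is 1 or 3, never 0 or 2.
-- Hence "equal or at distance 2" is an equivalence relation whose classes are exactly the
-- maximal 2-cliques, and among any three points two are at distance 2, so there are at most
-- two classes.
module Submission where

open import Defs
open import Data.Nat using (ℕ; zero; suc)
open import Data.Fin.Subset using (Subset)
open import Data.Sum using (_⊎_)
open import Relation.Binary.PropositionalEquality using (_≡_)

open import Data.Empty using (⊥-elim)
open import Data.Fin using (Fin) renaming (_≟_ to _≟ᶠ_)
open import Data.Fin.Subset using (_∈_; _⊆_; _∪_; ⁅_⁆; Nonempty)
open import Data.Fin.Subset.Properties
  using (_∈?_; nonempty?; ⊆-antisym; p⊆p∪q; x∈p∪q⁺; x∈p∪q⁻; x∈⁅x⁆; x∈⁅y⁆⇒x≡y)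
open import Data.Nat using () renaming (_≟_ to _≟ⁿ_)
open import Data.Product using (_×_; _,_; proj₁; proj₂)
open import Data.Sum using (inj₁; inj₂)
open import Data.Vec using ([])
open import Function using (id; flip)
open import Relation.Binary.PropositionalEquality using (_≢_; refl; sym; trans)
open import Relation.Nullary using (¬_; yes; no)

Symmetric₃ : (ℕ → ℕ → ℕ → Set) → Set
Symmetric₃ P = (∀ {a b c} → P a b c → P b a c) × (∀ {a b c} → P a b c → P a c b)

SameMultiset-elim : ∀ {P} → Symmetric₃ P → ∀ {a b c p q r} →
  SameMultiset a b c p q r → P p q r → P a b c
SameMultiset-elim (s₁₂ , s₂₃) (inj₁ (refl , refl , refl)) = id
SameMultiset-elim (s₁₂ , s₂₃) (inj₂ (inj₁ (refl , refl , refl))) = s₂₃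
SameMultiset-elim (s₁₂ , s₂₃) (inj₂ (inj₂ (inj₁ (refl , refl , refl)))) = s₁₂
SameMultiset-elim (s₁₂ , s₂₃) (inj₂ (inj₂ (inj₂ (inj₁ (refl , refl , refl))))) =
  λ x → s₂₃ (s₁₂ x)
SameMultiset-elim (s₁₂ , s₂₃) (inj₂ (inj₂ (inj₂ (inj₂ (inj₁ (refl , refl , refl)))))) =
  λ x → s₁₂ (s₂₃ x)
SameMultiset-elim (s₁₂ , s₂₃) (inj₂ (inj₂ (inj₂ (inj₂ (inj₂ (refl , refl , refl)))))) =
  λ x → s₁₂ (s₂₃ (s₁₂ x))

AllowedTriangle-elim : ∀ {P} → Symmetric₃ P → P 1 1 2 → P 1 2 3 → P 2 2 2 →
  ∀ {a b c} → AllowedTriangle a b c → P a b c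
AllowedTriangle-elim sym₃ p₁₁₂ p₁₂₃ p₂₂₂ (inj₁ t)        = SameMultiset-elim sym₃ t p₁₁₂
AllowedTriangle-elim sym₃ p₁₁₂ p₁₂₃ p₂₂₂ (inj₂ (inj₁ t)) = SameMultiset-elim sym₃ t p₁₂₃
AllowedTriangle-elim sym₃ p₁₁₂ p₁₂₃ p₂₂₂ (inj₂ (inj₂ t)) = SameMultiset-elim sym₃ t p₂₂₂

AllowedTriangle-has-2 : ∀ {a b c} → AllowedTriangle a b c → a ≢ 2 → b ≢ 2 → ¬ c ≢ 2
AllowedTriangle-has-2 = AllowedTriangle-elim {P = Has2}
  ((λ h b a c → h a b c) , (λ h a c b → h a b c))
  (λ _ _ c → c refl) (λ _ b _ → b refl) (λ a _ _ → a refl)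
  where
  Has2 : ℕ → ℕ → ℕ → Set
  Has2 a b c = a ≢ 2 → b ≢ 2 → ¬ c ≢ 2

AllowedTriangle-2-2⇒2 : ∀ {a b c} → AllowedTriangle a b c → a ≡ 2 → b ≡ 2 → c ≡ 2
AllowedTriangle-2-2⇒2 t = proj₁ (AllowedTriangle-elim {P = Closed2}
  ((λ (f , g , h) → flip f , flip h , flip g) , (λ (f , g , h) → flip h , flip g , flip f))
  ((λ ()) , (λ ()) , (λ _ ()))
  ((λ ()) , (λ _ ()) , (λ ()))
  ((λ _ _ → refl) , (λ _ _ → refl) , (λ _ _ → refl))
  t)
  where
  Closed2 : ℕ → ℕ → ℕ → Set
  Closed2 a b c = (a ≡ 2 → b ≡ 2 → c ≡ 2) × (b ≡ 2 → c ≡ 2 → a ≡ 2) × (c ≡ 2 → a ≡ 2 → b ≡ 2)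

module _ {n : ℕ} (M : FiniteMetric n) where

  Dist2Transitive : Set
  Dist2Transitive = ∀ x y z → x ≢ y → y ≢ z → x ≢ z →
    dist M x y ≡ 2 → dist M y z ≡ 2 → dist M x z ≡ 2

  InClass⇒Dist2Transitive : InClass M → Dist2Transitive
  InClass⇒Dist2Transitive (_ , allowed) x y z x≢y y≢z x≢z =
    AllowedTriangle-2-2⇒2 (allowed x y z x≢y y≢z x≢z)

  TwoClique-∪-⁅⁆ : ∀ {C y} → TwoClique M C →
    (∀ b → b ∈ C → y ≢ b → dist M y b ≡ 2) → TwoClique M (C ∪ ⁅ y ⁆)
  TwoClique-∪-⁅⁆ {C} {y} clique y-near a b a∈ b∈ a≢b
    with x∈p∪q⁻ C ⁅ y ⁆ a∈ | x∈p∪q⁻ C ⁅ y ⁆ b∈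
  ... | inj₁ a∈C | inj₁ b∈C = clique a b a∈C b∈C a≢b
  ... | inj₂ a∈y | inj₁ b∈C rewrite x∈⁅y⁆⇒x≡y y a∈y = y-near b b∈C a≢b
  ... | inj₁ a∈C | inj₂ b∈y rewrite x∈⁅y⁆⇒x≡y y b∈y =
    trans (dist-sym M a y) (y-near a a∈C (λ y≡a → a≢b (sym y≡a)))
  ... | inj₂ a∈y | inj₂ b∈y =
    ⊥-elim (a≢b (trans (x∈⁅y⁆⇒x≡y y a∈y) (sym (x∈⁅y⁆⇒x≡y y b∈y))))

  TwoClique-⁅⁆ : ∀ x → TwoClique M ⁅ x ⁆
  TwoClique-⁅⁆ x a b a∈ b∈ a≢b =
    ⊥-elim (a≢b (trans (x∈⁅y⁆⇒x≡y x a∈) (sym (x∈⁅y⁆⇒x≡y x b∈))))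

  MaximalTwoClique-nonempty : Fin n → ∀ {C} → MaximalTwoClique M C → Nonempty C
  MaximalTwoClique-nonempty z {C} (_ , maximal) with nonempty? C
  ... | yes nonempty = nonempty
  ... | no empty = ⊥-elim (maximal ⁅ z ⁆ (TwoClique-⁅⁆ z)
    ((λ {x} x∈C → ⊥-elim (empty (x , x∈C))) , z , x∈⁅x⁆ z , λ z∈C → empty (z , z∈C)))

  module _ (dist2-trans : Dist2Transitive) where

    MaximalTwoClique-closed : ∀ {C x y} → MaximalTwoClique M C → x ∈ C → x ≢ y →
      dist M x y ≡ 2 → y ∈ C
    MaximalTwoClique-closed {C} {x} {y} (clique , maximal) x∈C x≢y dxy with y ∈? C
    ... | yes y∈C = y∈C
    ... | no y∉C = ⊥-elim (maximal (C ∪ ⁅ y ⁆) (TwoClique-∪-⁅⁆ clique y-near)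
      (p⊆p∪q ⁅ y ⁆ , y , x∈p∪q⁺ (inj₂ (x∈⁅x⁆ y)) , y∉C))
      where
      dyx : dist M y x ≡ 2
      dyx = trans (dist-sym M y x) dxy
      y-near : ∀ b → b ∈ C → y ≢ b → dist M y b ≡ 2
      y-near b b∈C y≢b with x ≟ᶠ b
      ... | yes refl = dyx
      ... | no x≢b = dist2-trans y x b (λ y≡x → x≢y (sym y≡x)) x≢b y≢b
                       dyx (clique x b x∈C b∈C x≢b)

    MaximalTwoClique-⊆ : ∀ {C D x} → MaximalTwoClique M C → MaximalTwoClique M D →
      x ∈ C → x ∈ D → C ⊆ D
    MaximalTwoClique-⊆ {x = x} maxC maxD x∈C x∈D {y} y∈C with x ≟ᶠ y
    ... | yes refl = x∈D
    ... | no x≢y = MaximalTwoClique-closed maxD x∈D x≢y (proj₁ maxC x y x∈C y∈C x≢y)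

    MaximalTwoClique-overlap⇒≡ : ∀ {C D x} → MaximalTwoClique M C → MaximalTwoClique M D →
      x ∈ C → x ∈ D → C ≡ D
    MaximalTwoClique-overlap⇒≡ maxC maxD x∈C x∈D =
      ⊆-antisym (MaximalTwoClique-⊆ maxC maxD x∈C x∈D) (MaximalTwoClique-⊆ maxD maxC x∈D x∈C)

    MaximalTwoClique-≡-or-apart : ∀ {C D x y} →
      MaximalTwoClique M C → MaximalTwoClique M D → x ∈ C → y ∈ D →
      C ≡ D ⊎ (x ≢ y × dist M x y ≢ 2)
    MaximalTwoClique-≡-or-apart {x = x} {y} maxC maxD x∈C y∈D with x ≟ᶠ y
    ... | yes refl = inj₁ (MaximalTwoClique-overlap⇒≡ maxC maxD x∈C y∈D)
    ... | no x≢y with dist M x y ≟ⁿ 2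
    ... | yes dxy = inj₁ (MaximalTwoClique-overlap⇒≡ maxC maxD
                            (MaximalTwoClique-closed maxC x∈C x≢y dxy) y∈D)
    ... | no dxy≢2 = inj₂ (x≢y , dxy≢2)

lemma2p5 : ∀ (n : ℕ) (M : FiniteMetric n) → InClass M →
    ∀ (C₁ C₂ C₃ : Subset n) →
      MaximalTwoClique M C₁ → MaximalTwoClique M C₂ → MaximalTwoClique M C₃ →
      C₁ ≡ C₂ ⊎ C₁ ≡ C₃ ⊎ C₂ ≡ C₃
lemma2p5 zero M inClass [] [] [] _ _ _ = inj₁ refl
lemma2p5 (suc n) M inClass C₁ C₂ C₃ max₁ max₂ max₃
  with MaximalTwoClique-nonempty M Fin.zero max₁
     | MaximalTwoClique-nonempty M Fin.zero max₂
     | MaximalTwoClique-nonempty M Fin.zero max₃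
... | x₁ , x₁∈ | x₂ , x₂∈ | x₃ , x₃∈
  with ≡-or-apart max₁ max₂ x₁∈ x₂∈ | ≡-or-apart max₁ max₃ x₁∈ x₃∈
     | ≡-or-apart max₂ max₃ x₂∈ x₃∈
  where ≡-or-apart = MaximalTwoClique-≡-or-apart M (InClass⇒Dist2Transitive M inClass)
... | inj₁ C₁≡C₂ | _ | _ = inj₁ C₁≡C₂
... | inj₂ _ | inj₁ C₁≡C₃ | _ = inj₂ (inj₁ C₁≡C₃)
... | inj₂ _ | inj₂ _ | inj₁ C₂≡C₃ = inj₂ (inj₂ C₂≡C₃)
... | inj₂ (x₁≢x₂ , d₁₂) | inj₂ (x₁≢x₃ , d₁₃) | inj₂ (x₂≢x₃ , d₂₃) =
  ⊥-elim (AllowedTriangle-has-2 (proj₂ inClass x₁ x₂ x₃ x₁≢x₂ x₂≢x₃ x₁≢x₃) d₁₂ d₂₃ d₁₃)
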